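{- Let $\mathcal{C}$ be either $\mathbf{Grphs}$ or $\mathbf{StGrphs}$, and let $f:A\to B$ be a morphism of $\mathcal{C}$. Let $p_0,p_1:A\times A\to A$ be the product projections and $i_0,i_1:B\to B+B$ the coproduct injections in $\mathcal{C}$. Let $k:R_f\to A\times A$ be the equalizer of $fp_0$ and $fp_1$; let $q:A\to I$ be the coequalizer of $p_0k$ and $p_1k$; let $k^*:B+B\to R_f^*$ be the coequalizer of $i_0f$ and $i_1f$; and let $q^*:I^*\to B$ be the equalizer of $k^*i_0$ and $k^*i_1$. Then there is a unique morphism $h:I\to I^*$ with $q^*hq=f$, and this $h$ is an isomorphism in $\mathcal{C}$.
   Context: A graph $G$ consists of a vertex set $V(G)$, an edge set $E(G)$ disjoint from it, and an incidence function $\psi_G$ assigning to each edge an unordered pair $\{x,y\}$ of (not necessarily distinct) vertices; multiple edges and loops are allowed. The part set is $P(G)=E(G)\cup V(G)$, and for a vertex $v$ we set $\psi_G(v)=\{v,v\}$. A graph morphism $f:G\to H$ is a function $f:P(G)\to P(H)$ with $f(V(G))\subseteq V(H)$ such that $\psi_H(f(e))=\{f(x),f(y)\}$ whenever $\psi_G(e)=\{x,y\}$, for all $e\in P(G)$. A strict graph morphism is a graph morphism sending edges to edges. $\mathbf{Grphs}$ (resp. $\mathbf{StGrphs}$) is the category of all graphs with graph morphisms (resp. strict graph morphisms). Products, coproducts, equalizers and coequalizers are meant in the categorical sense; they exist in both categories. Concretely: the coproduct is disjoint union. The equalizer of $f,g:A\to B$ is the inclusion of the subgraph $Eq$ of $A$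 with $P(Eq)=\{a\in P(A): f(a)=g(a)$, and if $\psi_A(a)=\{a_1,a_2\}$ then $f(a_i)=g(a_i)$ for $i=1,2\}$. The coequalizer of $f,g:A\to B$ is the quotient map $B\to Coeq$ where $P(Coeq)=P(B)/\sim$, $\sim$ being the equivalence relation generated by $f(a)\sim g(a)$ for $a\in P(A)$, with a class containing a vertex being a vertex. In $\mathbf{Grphs}$ the product $A\times B$ has vertex set $V(A)\times V(B)$ and, for $e\in P(A)$ with $\psi_A(e)=\{a_1,a_2\}$ and $f\in P(B)$ with $\psi_B(f)=\{b_1,b_2\}$, a part $(e,f)$ with ends $(a_1,b_1),(a_2,b_2)$ and, if $a_1\ne a_2$ and $b_1\ne b_2$, a further part $\overline{(e,f)}$ with ends $(a_1,b_2),(a_2,b_1)$, both projecting to $e$ and $f$; in $\mathbf{StGrphs}$ the product is the same but with the parts $(e,f)$ and $\overline{(e,f)}$ for which exactly one of $e,f$ is a vertex deleted. -}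

module Defs where

open import Data.Product using (Σ; _×_; _,_)
open import Data.Sum using (_⊎_)
open import Data.Unit using (⊤)
open import Relation.Nullary using (¬_)
open import Relation.Binary.Structures using (IsEquivalence)

-- A graph in the sense of the paper: a part set P(G) = E(G) ∪ V(G),
-- a predicate singling out the vertices (the other parts are edges),
-- and an incidence function assigning to each part an unordered pair
-- of vertices, with ψ(v) = {v,v} for vertices.
-- The part set is a setoid (constructive rendering of a set, so that
-- quotients such as coequalizers exist).
record Graph : Set₁ where
  field
    Part      : Set
    _≈_       : Part → Part → Set
    ≈-isEquiv : IsEquivalence _≈_
    IsVertex  : Part → Set
    vertex-resp : ∀ {x y} → x ≈ y → IsVertex x → IsVertex y
    end₁ end₂ : Part → Part
    end₁-vertex : ∀ x → IsVertex (end₁ x)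
    end₂-vertex : ∀ x → IsVertex (end₂ x)
    vertex-ends : ∀ {x} → IsVertex x → (end₁ x ≈ x) × (end₂ x ≈ x)
    ends-resp : ∀ {x y} → x ≈ y →
      ((end₁ x ≈ end₁ y) × (end₂ x ≈ end₂ y)) ⊎ ((end₁ x ≈ end₂ y) × (end₂ x ≈ end₁ y))

open Graph public

UPairEq : (G : Graph) → Part G → Part G → Part G → Part G → Set
UPairEq G a b c d = ((_≈_ G a c) × (_≈_ G b d)) ⊎ ((_≈_ G a d) × (_≈_ G b c))

data Cat : Set where
  Grphs StGrphs : Cat

IsEdge : (G : Graph) → Part G → Set
IsEdge G x = ¬ IsVertex G x

Strictness : Cat → (G H : Graph) → (Part G → Part H) → Set
Strictness Grphs   G H f = ⊤
Strictness StGrphs G H f = ∀ x → IsEdge G x → IsEdge H (f x)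

record Hom (𝒞 : Cat) (G H : Graph) : Set where
  field
    fun  : Part G → Part H
    resp : ∀ {x y} → _≈_ G x y → _≈_ H (fun x) (fun y)
    pres-vertex : ∀ {x} → IsVertex G x → IsVertex H (fun x)
    pres-ends : ∀ x → UPairEq H (end₁ H (fun x)) (end₂ H (fun x))
                                (fun (end₁ G x)) (fun (end₂ G x))
    strict : Strictness 𝒞 G H fun

open Hom public

infixr 9 _∘_
_∘_ : ∀ {𝒞 G H K} → Hom 𝒞 H K → Hom 𝒞 G H → Hom 𝒞 G K
_∘_ {Grphs} {G} {H} {K} g f = record
  { fun = λ x → fun g (fun f x)
  ; resp = λ e → resp g (resp f e)
  ; pres-vertex = λ v → pres-vertex g (pres-vertex f v)
  ; pres-ends = λ x → comp-ends g f x
  ; strict = _ }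
  where
  open import Data.Sum using (inj₁; inj₂)
  open IsEquivalence
  comp-ends : (g : Hom Grphs H K) (f : Hom Grphs G H) (x : Part G) →
    UPairEq K (end₁ K (fun g (fun f x))) (end₂ K (fun g (fun f x)))
              (fun g (fun f (end₁ G x))) (fun g (fun f (end₂ G x)))
  comp-ends g f x with pres-ends g (fun f x) | pres-ends f x
  ... | inj₁ (a , b) | inj₁ (c , d) = inj₁ (trans (≈-isEquiv K) a (resp g c) , trans (≈-isEquiv K) b (resp g d))
  ... | inj₁ (a , b) | inj₂ (c , d) = inj₂ (trans (≈-isEquiv K) a (resp g c) , trans (≈-isEquiv K) b (resp g d))
  ... | inj₂ (a , b) | inj₁ (c , d) = inj₂ (trans (≈-isEquiv K) a (resp g d) , trans (≈-isEquiv K) b (resp g c))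
  ... | inj₂ (a , b) | inj₂ (c , d) = inj₁ (trans (≈-isEquiv K) a (resp g d) , trans (≈-isEquiv K) b (resp g c))
_∘_ {StGrphs} {G} {H} {K} g f = record
  { fun = λ x → fun g (fun f x)
  ; resp = λ e → resp g (resp f e)
  ; pres-vertex = λ v → pres-vertex g (pres-vertex f v)
  ; pres-ends = λ x → comp-ends x
  ; strict = λ x ne → strict g (fun f x) (strict f x ne) }
  where
  open import Data.Sum using (inj₁; inj₂)
  open IsEquivalence
  comp-ends : (x : Part G) →
    UPairEq K (end₁ K (fun g (fun f x))) (end₂ K (fun g (fun f x)))
              (fun g (fun f (end₁ G x))) (fun g (fun f (end₂ G x)))
  comp-ends x with pres-ends g (fun f x) | pres-ends f x
  ... | inj₁ (a , b) | inj₁ (c , d) = inj₁ (trans (≈-isEquiv K) a (resp g c) , trans (≈-isEquiv K) b (resp g d))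
  ... | inj₁ (a , b) | inj₂ (c , d) = inj₂ (trans (≈-isEquiv K) a (resp g c) , trans (≈-isEquiv K) b (resp g d))
  ... | inj₂ (a , b) | inj₁ (c , d) = inj₂ (trans (≈-isEquiv K) a (resp g d) , trans (≈-isEquiv K) b (resp g c))
  ... | inj₂ (a , b) | inj₂ (c , d) = inj₁ (trans (≈-isEquiv K) a (resp g d) , trans (≈-isEquiv K) b (resp g c))

idH : ∀ {𝒞 G} → Hom 𝒞 G G
idH {Grphs} {G} = record
  { fun = λ x → x ; resp = λ e → e ; pres-vertex = λ v → v
  ; pres-ends = λ x → inj₁ (refl (≈-isEquiv G) , refl (≈-isEquiv G)) ; strict = _ }
  where open import Data.Sum using (inj₁); open IsEquivalence
idH {StGrphs} {G} = record
  { fun = λ x → x ; resp = λ e → e ; pres-vertex = λ v → v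
  ; pres-ends = λ x → inj₁ (refl (≈-isEquiv G) , refl (≈-isEquiv G)) ; strict = λ x ne → ne }
  where open import Data.Sum using (inj₁); open IsEquivalence

infix 4 _≗_
_≗_ : ∀ {𝒞 G H} → Hom 𝒞 G H → Hom 𝒞 G H → Set
_≗_ {H = H} f g = ∀ x → _≈_ H (fun f x) (fun g x)

IsProduct : (𝒞 : Cat) {A B P : Graph} → Hom 𝒞 P A → Hom 𝒞 P B → Set₁
IsProduct 𝒞 {A} {B} {P} p₀ p₁ =
  (X : Graph) (f : Hom 𝒞 X A) (g : Hom 𝒞 X B) →
  Σ (Hom 𝒞 X P) λ u → ((p₀ ∘ u ≗ f) × (p₁ ∘ u ≗ g)) ×
    ((u' : Hom 𝒞 X P) → p₀ ∘ u' ≗ f → p₁ ∘ u' ≗ g → u' ≗ u)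

IsCoproduct : (𝒞 : Cat) {A B S : Graph} → Hom 𝒞 A S → Hom 𝒞 B S → Set₁
IsCoproduct 𝒞 {A} {B} {S} i₀ i₁ =
  (X : Graph) (f : Hom 𝒞 A X) (g : Hom 𝒞 B X) →
  Σ (Hom 𝒞 S X) λ u → ((u ∘ i₀ ≗ f) × (u ∘ i₁ ≗ g)) ×
    ((u' : Hom 𝒞 S X) → u' ∘ i₀ ≗ f → u' ∘ i₁ ≗ g → u' ≗ u)

IsEqualizer : (𝒞 : Cat) {A B E : Graph} → Hom 𝒞 A B → Hom 𝒞 A B → Hom 𝒞 E A → Set₁
IsEqualizer 𝒞 {A} {B} {E} f g e =
  (f ∘ e ≗ g ∘ e) ×
  ((X : Graph) (m : Hom 𝒞 X A) → f ∘ m ≗ g ∘ m →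
    Σ (Hom 𝒞 X E) λ u → (e ∘ u ≗ m) × ((u' : Hom 𝒞 X E) → e ∘ u' ≗ m → u' ≗ u))

IsCoequalizer : (𝒞 : Cat) {A B C : Graph} → Hom 𝒞 A B → Hom 𝒞 A B → Hom 𝒞 B C → Set₁
IsCoequalizer 𝒞 {A} {B} {C} f g c =
  (c ∘ f ≗ c ∘ g) ×
  ((X : Graph) (m : Hom 𝒞 B X) → m ∘ f ≗ m ∘ g →
    Σ (Hom 𝒞 C X) λ u → (u ∘ c ≗ m) × ((u' : Hom 𝒞 C X) → u' ∘ c ≗ m → u' ≗ u))

IsIso : (𝒞 : Cat) {G H : Graph} → Hom 𝒞 G H → Set
IsIso 𝒞 {G} {H} h = Σ (Hom 𝒞 H G) λ g → (g ∘ h ≗ idH) × (h ∘ g ≗ idH)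

-- The coequalizer q is surjective and the equalizer q* is injective: both facts are
-- detected by small test graphs, namely two copies of a graph glued along an image, and
-- a single part with its two ends.  Probing with the latter through the product and the
-- equalizer R shows that q identifies any two parts that f identifies; gluing along the
-- image of f and probing through the coproduct and the coequalizer R* shows that q*
-- lands in the image of f.  So the comparison map h : I → I* obtained from the universal
-- properties is bijective, and x ↦ q a, for any a with f a ≈ q* x, is a morphism inverse to it.
module Submission where

open import Defs
open import Data.Bool using (Bool; true; false)
open import Data.Empty using (⊥-elim)
open import Data.Product using (Σ; _×_; _,_; proj₁; proj₂)
open import Data.Sum using (_⊎_; inj₁; inj₂)
open import Data.Unit using (⊤; tt)
open import Level using (0ℓ)
open import Relation.Binary.Bundles using (Setoid)
open import Relation.Binary.PropositionalEquality as ≡ using (_≡_)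
open import Relation.Nullary using (¬_)
import Relation.Binary.Reasoning.Setoid as SetoidReasoning

parts : Graph → Setoid 0ℓ 0ℓ
parts G = record { Carrier = Part G ; _≈_ = _≈_ G ; isEquivalence = ≈-isEquiv G }

module _ (G : Graph) where
  open Setoid (parts G) public using ()
    renaming (refl to ≈-refl; sym to ≈-sym; trans to ≈-trans)

UPairEq-sym : (G : Graph) {a b c d : Part G} → UPairEq G a b c d → UPairEq G c d a b
UPairEq-sym G (inj₁ (ac , bd)) = inj₁ (≈-sym G ac , ≈-sym G bd)
UPairEq-sym G (inj₂ (ad , bc)) = inj₂ (≈-sym G bc , ≈-sym G ad)

UPairEq-trans : (G : Graph) {a b c d e f : Part G} →
  UPairEq G a b c d → UPairEq G c d e f → UPairEq G a b e f
UPairEq-trans G (inj₁ (ac , bd)) (inj₁ (ce , df)) = inj₁ (≈-trans G ac ce , ≈-trans G bd df)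
UPairEq-trans G (inj₁ (ac , bd)) (inj₂ (cf , de)) = inj₂ (≈-trans G ac cf , ≈-trans G bd de)
UPairEq-trans G (inj₂ (ad , bc)) (inj₁ (ce , df)) = inj₂ (≈-trans G ad df , ≈-trans G bc ce)
UPairEq-trans G (inj₂ (ad , bc)) (inj₂ (cf , de)) = inj₁ (≈-trans G ad de , ≈-trans G bc cf)

UPairEq-map : {X : Set} {G H : Graph} (F : X → Part G) (Q : X → Part H) →
  (∀ {a a'} → _≈_ G (F a) (F a') → _≈_ H (Q a) (Q a')) →
  ∀ {a b c d} → UPairEq G (F a) (F b) (F c) (F d) → UPairEq H (Q a) (Q b) (Q c) (Q d)
UPairEq-map F Q Q-resp (inj₁ (ac , bd)) = inj₁ (Q-resp ac , Q-resp bd)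
UPairEq-map F Q Q-resp (inj₂ (ad , bc)) = inj₂ (Q-resp ad , Q-resp bc)

ends-≈-vertex : (G : Graph) {y a b : Part G} → IsVertex G y →
  UPairEq G (end₁ G y) (end₂ G y) a b → _≈_ G a y × _≈_ G b y
ends-≈-vertex G vertex pair with vertex-ends G vertex | pair
... | y₁≈y , y₂≈y | inj₁ (y₁a , y₂b) = ≈-trans G (≈-sym G y₁a) y₁≈y , ≈-trans G (≈-sym G y₂b) y₂≈y
... | y₁≈y , y₂≈y | inj₂ (y₁b , y₂a) = ≈-trans G (≈-sym G y₂a) y₂≈y , ≈-trans G (≈-sym G y₁b) y₁≈y

strictness : (𝒞 : Cat) {G H : Graph} (φ : Part G → Part H) →
  (𝒞 ≡ StGrphs → ∀ x → IsEdge G x → IsEdge H (φ x)) → Strictness 𝒞 G H φ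
strictness Grphs   φ preserves = tt
strictness StGrphs φ preserves = preserves ≡.refl

preserves-edges : {𝒞 : Cat} {G H : Graph} (φ : Hom 𝒞 G H) →
  𝒞 ≡ StGrphs → ∀ x → IsEdge G x → IsEdge H (fun φ x)
preserves-edges φ ≡.refl = strict φ

-- `_∘_` and `idH` are defined by cases on 𝒞, so their action on parts only computes after a split.
fun-∘ : (𝒞 : Cat) {G H K : Graph} (g : Hom 𝒞 H K) (h : Hom 𝒞 G H) (x : Part G) →
  fun (g ∘ h) x ≡ fun g (fun h x)
fun-∘ Grphs   g h x = ≡.refl
fun-∘ StGrphs g h x = ≡.refl

fun-id : (𝒞 : Cat) {G : Graph} (x : Part G) → fun (idH {𝒞} {G}) x ≡ x
fun-id Grphs   x = ≡.refl
fun-id StGrphs x = ≡.refl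

-- `_≗_` unfolds to a Π-type, which hides its two morphisms from unification; wrapping it
-- in a record lets Agda infer them in equational reasoning.
infix 4 _≈ₕ_
record _≈ₕ_ {𝒞 : Cat} {G H : Graph} (g h : Hom 𝒞 G H) : Set where
  constructor ≗⇒≈ₕ
  field at : g ≗ h

open _≈ₕ_ public

Homs : Cat → Graph → Graph → Setoid 0ℓ 0ℓ
Homs 𝒞 G H = record
  { Carrier = Hom 𝒞 G H
  ; _≈_ = _≈ₕ_
  ; isEquivalence = record
    { refl = ≗⇒≈ₕ (λ x → ≈-refl H)
    ; sym = λ e → ≗⇒≈ₕ (λ x → ≈-sym H (at e x))
    ; trans = λ e e' → ≗⇒≈ₕ (λ x → ≈-trans H (at e x) (at e' x)) } }

module _ {𝒞 : Cat} {G H : Graph} where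
  open Setoid (Homs 𝒞 G H) public using ()
    renaming (refl to ≈ₕ-refl; sym to ≈ₕ-sym; trans to ≈ₕ-trans)

module _ {𝒞 : Cat} where

  ∘-pointwise : {G H H' K : Graph} {g : Hom 𝒞 H K} {h : Hom 𝒞 G H}
    {g' : Hom 𝒞 H' K} {h' : Hom 𝒞 G H'} →
    (∀ x → _≈_ K (fun g (fun h x)) (fun g' (fun h' x))) → g ∘ h ≈ₕ g' ∘ h'
  ∘-pointwise {K = K} {g} {h} {g'} {h'} e = ≗⇒≈ₕ λ x → begin
    fun (g ∘ h) x       ≡⟨ fun-∘ 𝒞 g h x ⟩
    fun g (fun h x)     ≈⟨ e x ⟩
    fun g' (fun h' x)   ≡⟨ fun-∘ 𝒞 g' h' x ⟨
    fun (g' ∘ h') x     ∎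
    where open SetoidReasoning (parts K)

  ∘-at : {G H H' K : Graph} {g : Hom 𝒞 H K} {h : Hom 𝒞 G H}
    {g' : Hom 𝒞 H' K} {h' : Hom 𝒞 G H'} →
    g ∘ h ≈ₕ g' ∘ h' → ∀ x → _≈_ K (fun g (fun h x)) (fun g' (fun h' x))
  ∘-at {K = K} {g} {h} {g'} {h'} e x = begin
    fun g (fun h x)     ≡⟨ fun-∘ 𝒞 g h x ⟨
    fun (g ∘ h) x       ≈⟨ at e x ⟩
    fun (g' ∘ h') x     ≡⟨ fun-∘ 𝒞 g' h' x ⟩
    fun g' (fun h' x)   ∎
    where open SetoidReasoning (parts K)

  ∘-resp-≈ₕ : {G H K : Graph} {g g' : Hom 𝒞 H K} {h h' : Hom 𝒞 G H} →
    g ≈ₕ g' → h ≈ₕ h' → g ∘ h ≈ₕ g' ∘ h'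
  ∘-resp-≈ₕ {K = K} {g} e e' = ∘-pointwise (λ x → ≈-trans K (resp g (at e' x)) (at e _))

  ∘-resp-≈ₕˡ : {G H K : Graph} {g g' : Hom 𝒞 H K} {h : Hom 𝒞 G H} →
    g ≈ₕ g' → g ∘ h ≈ₕ g' ∘ h
  ∘-resp-≈ₕˡ e = ∘-resp-≈ₕ e ≈ₕ-refl

  ∘-resp-≈ₕʳ : {G H K : Graph} {g : Hom 𝒞 H K} {h h' : Hom 𝒞 G H} →
    h ≈ₕ h' → g ∘ h ≈ₕ g ∘ h'
  ∘-resp-≈ₕʳ e = ∘-resp-≈ₕ ≈ₕ-refl e

  ∘-assoc : {G H K L : Graph} (f : Hom 𝒞 K L) (g : Hom 𝒞 H K) (h : Hom 𝒞 G H) →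
    (f ∘ g) ∘ h ≈ₕ f ∘ (g ∘ h)
  ∘-assoc {L = L} f g h = ≗⇒≈ₕ λ x → begin
    fun ((f ∘ g) ∘ h) x       ≡⟨ fun-∘ 𝒞 (f ∘ g) h x ⟩
    fun (f ∘ g) (fun h x)     ≡⟨ fun-∘ 𝒞 f g (fun h x) ⟩
    fun f (fun g (fun h x))   ≡⟨ ≡.cong (fun f) (fun-∘ 𝒞 g h x) ⟨
    fun f (fun (g ∘ h) x)     ≡⟨ fun-∘ 𝒞 f (g ∘ h) x ⟨
    fun (f ∘ (g ∘ h)) x       ∎
    where open SetoidReasoning (parts L)

-- `Link V` is one part with two end vertices; the part is a vertex exactly when V holds,
-- in which case all three parts are identified.  A morphism out of `Link V` picks a part
-- together with an ordering of its ends.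
data LinkPart : Set where
  body tip₁ tip₂ : LinkPart

module _ (V : Set) where

  private
    _∼_ : LinkPart → LinkPart → Set
    x ∼ y = (x ≡ y) ⊎ V

    IsLinkVertex : LinkPart → Set
    IsLinkVertex body = V
    IsLinkVertex tip₁ = ⊤
    IsLinkVertex tip₂ = ⊤

    linkEnd₁ linkEnd₂ : LinkPart → LinkPart
    linkEnd₁ body = tip₁
    linkEnd₁ x    = x
    linkEnd₂ body = tip₂
    linkEnd₂ x    = x

    collapsed-vertex : V → ∀ x → IsLinkVertex x
    collapsed-vertex v body = v
    collapsed-vertex v tip₁ = tt
    collapsed-vertex v tip₂ = tt

    linkEnd₁-vertex : ∀ x → IsLinkVertex (linkEnd₁ x)
    linkEnd₁-vertex body = tt
    linkEnd₁-vertex tip₁ = tt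
    linkEnd₁-vertex tip₂ = tt

    linkEnd₂-vertex : ∀ x → IsLinkVertex (linkEnd₂ x)
    linkEnd₂-vertex body = tt
    linkEnd₂-vertex tip₁ = tt
    linkEnd₂-vertex tip₂ = tt

    vertex-resp′ : ∀ {x y} → x ∼ y → IsLinkVertex x → IsLinkVertex y
    vertex-resp′ (inj₁ ≡.refl) vertex = vertex
    vertex-resp′ {y = y} (inj₂ v) _ = collapsed-vertex v y

    vertex-ends′ : ∀ {x} → IsLinkVertex x → (linkEnd₁ x ∼ x) × (linkEnd₂ x ∼ x)
    vertex-ends′ {body} v = inj₂ v , inj₂ v
    vertex-ends′ {tip₁} _ = inj₁ ≡.refl , inj₁ ≡.refl
    vertex-ends′ {tip₂} _ = inj₁ ≡.refl , inj₁ ≡.refl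

  Link : Graph
  Link = record
    { Part = LinkPart
    ; _≈_ = _∼_
    ; ≈-isEquiv = record
      { refl = inj₁ ≡.refl
      ; sym = λ { (inj₁ e) → inj₁ (≡.sym e) ; (inj₂ v) → inj₂ v }
      ; trans = λ { (inj₁ e) (inj₁ e') → inj₁ (≡.trans e e') ; (inj₂ v) _ → inj₂ v
                  ; (inj₁ _) (inj₂ v) → inj₂ v } }
    ; IsVertex = IsLinkVertex
    ; vertex-resp = vertex-resp′
    ; end₁ = linkEnd₁
    ; end₂ = linkEnd₂
    ; end₁-vertex = linkEnd₁-vertex
    ; end₂-vertex = linkEnd₂-vertex
    ; vertex-ends = vertex-ends′
    ; ends-resp = λ { (inj₁ ≡.refl) → inj₁ (inj₁ ≡.refl , inj₁ ≡.refl)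
                    ; (inj₂ v) → inj₁ (inj₂ v , inj₂ v) }
    }

module _ (𝒞 : Cat) {G : Graph} {V : Set} (y e₁ e₂ : Part G)
  (e₁-vertex : IsVertex G e₁) (e₂-vertex : IsVertex G e₂)
  (ends : UPairEq G (end₁ G y) (end₂ G y) e₁ e₂)
  (y-vertex : V → IsVertex G y)
  (y-edge : 𝒞 ≡ StGrphs → ¬ V → IsEdge G y) where

  private
    φ : LinkPart → Part G
    φ body = y
    φ tip₁ = e₁
    φ tip₂ = e₂

    collapses-to-y : V → ∀ x → _≈_ G (φ x) y
    collapses-to-y v body = ≈-refl G
    collapses-to-y v tip₁ = proj₁ (ends-≈-vertex G (y-vertex v) ends)
    collapses-to-y v tip₂ = proj₂ (ends-≈-vertex G (y-vertex v) ends)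

    φ-resp : ∀ {x x'} → _≈_ (Link V) x x' → _≈_ G (φ x) (φ x')
    φ-resp (inj₁ ≡.refl) = ≈-refl G
    φ-resp {x} {x'} (inj₂ v) = ≈-trans G (collapses-to-y v x) (≈-sym G (collapses-to-y v x'))

    φ-vertex : ∀ {x} → IsVertex (Link V) x → IsVertex G (φ x)
    φ-vertex {body} v = y-vertex v
    φ-vertex {tip₁} _ = e₁-vertex
    φ-vertex {tip₂} _ = e₂-vertex

    φ-ends : ∀ x → UPairEq G (end₁ G (φ x)) (end₂ G (φ x))
                             (φ (end₁ (Link V) x)) (φ (end₂ (Link V) x))
    φ-ends body = ends
    φ-ends tip₁ = inj₁ (vertex-ends G e₁-vertex)
    φ-ends tip₂ = inj₁ (vertex-ends G e₂-vertex)

    φ-edge : 𝒞 ≡ StGrphs → ∀ x → IsEdge (Link V) x → IsEdge G (φ x)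
    φ-edge strict body = y-edge strict
    φ-edge strict tip₁ edge = ⊥-elim (edge tt)
    φ-edge strict tip₂ edge = ⊥-elim (edge tt)

  pick : Hom 𝒞 (Link V) G
  pick = record { fun = φ ; resp = φ-resp ; pres-vertex = φ-vertex ; pres-ends = φ-ends
                ; strict = strictness 𝒞 φ φ-edge }

-- Taking `body` to be a vertex exactly when both y and y' are keeps both picks strict:
-- a strict φ cannot identify an edge with a vertex.
record Probe {𝒞 : Cat} {G H : Graph} (φ : Hom 𝒞 G H) (y y' : Part G) : Set where
  field
    left right : Hom 𝒞 (Link (IsVertex G y × IsVertex G y')) G
    left-body : fun left body ≡ y
    right-body : fun right body ≡ y'
    agree : φ ∘ left ≈ₕ φ ∘ right

probe : {𝒞 : Cat} {G H : Graph} (φ : Hom 𝒞 G H) {y y' : Part G} →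
  _≈_ H (fun φ y) (fun φ y') → Probe φ y y'
probe {𝒞} {G} {H} φ {y} {y'} φy≈φy' = probe-with ends-match
  where
  V = IsVertex G y × IsVertex G y'

  ends-match : UPairEq H (fun φ (end₁ G y)) (fun φ (end₂ G y))
                         (fun φ (end₁ G y')) (fun φ (end₂ G y'))
  ends-match = UPairEq-trans H (UPairEq-sym H (pres-ends φ y))
                 (UPairEq-trans H (ends-resp H φy≈φy') (pres-ends φ y'))

  y-edge : 𝒞 ≡ StGrphs → ¬ V → IsEdge G y
  y-edge strict not-V y-vertex =
    preserves-edges φ strict y' (λ y'-vertex → not-V (y-vertex , y'-vertex))
    (vertex-resp H φy≈φy' (pres-vertex φ y-vertex))

  y'-edge : 𝒞 ≡ StGrphs → ¬ V → IsEdge G y'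
  y'-edge strict not-V y'-vertex =
    preserves-edges φ strict y (λ y-vertex → not-V (y-vertex , y'-vertex))
    (vertex-resp H (≈-sym H φy≈φy') (pres-vertex φ y'-vertex))

  left : Hom 𝒞 (Link V) G
  left = pick 𝒞 y (end₁ G y) (end₂ G y) (end₁-vertex G y) (end₂-vertex G y)
              (inj₁ (≈-refl G , ≈-refl G)) proj₁ y-edge

  probe-towards : {t₁ t₂ : Part G} → IsVertex G t₁ → IsVertex G t₂ →
    UPairEq G (end₁ G y') (end₂ G y') t₁ t₂ →
    _≈_ H (fun φ (end₁ G y)) (fun φ t₁) → _≈_ H (fun φ (end₂ G y)) (fun φ t₂) →
    Probe φ y y'
  probe-towards {t₁} {t₂} t₁-vertex t₂-vertex y'-ends e₁ e₂ = record
    { left = left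
    ; right = right
    ; left-body = ≡.refl
    ; right-body = ≡.refl
    ; agree = ∘-pointwise λ { body → φy≈φy' ; tip₁ → e₁ ; tip₂ → e₂ } }
    where
    right = pick 𝒞 y' t₁ t₂ t₁-vertex t₂-vertex y'-ends proj₂ y'-edge

  probe-with : UPairEq H (fun φ (end₁ G y)) (fun φ (end₂ G y))
                         (fun φ (end₁ G y')) (fun φ (end₂ G y')) →
    Probe φ y y'
  probe-with (inj₁ (e₁ , e₂)) =
    probe-towards (end₁-vertex G y') (end₂-vertex G y') (inj₁ (≈-refl G , ≈-refl G)) e₁ e₂
  probe-with (inj₂ (e₁ , e₂)) =
    probe-towards (end₂-vertex G y') (end₁-vertex G y') (inj₂ (≈-refl G , ≈-refl G)) e₁ e₂

module _ {𝒞 : Cat} {G H : Graph} where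

  Image : Hom 𝒞 G H → Part H → Set
  Image φ b = Σ (Part G) λ a → _≈_ H b (fun φ a)

  Surjective : Hom 𝒞 G H → Set
  Surjective φ = ∀ b → Image φ b

  Injective : Hom 𝒞 G H → Set
  Injective φ = ∀ {x x'} → _≈_ H (fun φ x) (fun φ x') → _≈_ G x x'

module _ {𝒞 : Cat} {G H : Graph} (φ : Hom 𝒞 G H) where

  private
    Image-resp : ∀ {b b'} → _≈_ H b b' → Image φ b → Image φ b'
    Image-resp b≈b' (a , b≈φa) = a , ≈-trans H (≈-sym H b≈b') b≈φa

    Image-ends : ∀ {b} → Image φ b → Image φ (end₁ H b) × Image φ (end₂ H b)
    Image-ends {b} (a , b≈φa) with UPairEq-trans H (ends-resp H b≈φa) (pres-ends φ a)
    ... | inj₁ (e₁ , e₂) = (end₁ G a , e₁) , (end₂ G a , e₂)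
    ... | inj₂ (e₁ , e₂) = (end₂ G a , e₁) , (end₁ G a , e₂)

    _∼_ : Part H × Bool → Part H × Bool → Set
    (b , i) ∼ (b' , j) = _≈_ H b b' × ((i ≡ j) ⊎ Image φ b)

    ∼-sym : ∀ {x y} → x ∼ y → y ∼ x
    ∼-sym (b≈b' , inj₁ i≡j) = ≈-sym H b≈b' , inj₁ (≡.sym i≡j)
    ∼-sym (b≈b' , inj₂ im) = ≈-sym H b≈b' , inj₂ (Image-resp b≈b' im)

    ∼-trans : ∀ {x y z} → x ∼ y → y ∼ z → x ∼ z
    ∼-trans (b≈b' , inj₁ i≡j) (b'≈b'' , inj₁ j≡k) =
      ≈-trans H b≈b' b'≈b'' , inj₁ (≡.trans i≡j j≡k)
    ∼-trans (b≈b' , inj₂ im) (b'≈b'' , _) = ≈-trans H b≈b' b'≈b'' , inj₂ im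
    ∼-trans (b≈b' , inj₁ _) (b'≈b'' , inj₂ im) =
      ≈-trans H b≈b' b'≈b'' , inj₂ (Image-resp (≈-sym H b≈b') im)

    end₁-tag : ∀ {b} {i j : Bool} → (i ≡ j) ⊎ Image φ b → (i ≡ j) ⊎ Image φ (end₁ H b)
    end₁-tag (inj₁ i≡j) = inj₁ i≡j
    end₁-tag (inj₂ im) = inj₂ (proj₁ (Image-ends im))

    end₂-tag : ∀ {b} {i j : Bool} → (i ≡ j) ⊎ Image φ b → (i ≡ j) ⊎ Image φ (end₂ H b)
    end₂-tag (inj₁ i≡j) = inj₁ i≡j
    end₂-tag (inj₂ im) = inj₂ (proj₂ (Image-ends im))

    gluedEnd₁ gluedEnd₂ : Part H × Bool → Part H × Bool
    gluedEnd₁ (b , i) = end₁ H b , i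
    gluedEnd₂ (b , i) = end₂ H b , i

    ends-resp′ : ∀ {x y} → x ∼ y →
      ((gluedEnd₁ x ∼ gluedEnd₁ y) × (gluedEnd₂ x ∼ gluedEnd₂ y)) ⊎
      ((gluedEnd₁ x ∼ gluedEnd₂ y) × (gluedEnd₂ x ∼ gluedEnd₁ y))
    ends-resp′ (b≈b' , tag) with ends-resp H b≈b'
    ... | inj₁ (e₁ , e₂) = inj₁ ((e₁ , end₁-tag tag) , (e₂ , end₂-tag tag))
    ... | inj₂ (e₁ , e₂) = inj₂ ((e₁ , end₁-tag tag) , (e₂ , end₂-tag tag))

  Glued : Graph
  Glued = record
    { Part = Part H × Bool
    ; _≈_ = _∼_
    ; ≈-isEquiv = record { refl = ≈-refl H , inj₁ ≡.refl ; sym = ∼-sym ; trans = ∼-trans }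
    ; IsVertex = λ x → IsVertex H (proj₁ x)
    ; vertex-resp = λ x∼y → vertex-resp H (proj₁ x∼y)
    ; end₁ = gluedEnd₁
    ; end₂ = gluedEnd₂
    ; end₁-vertex = λ x → end₁-vertex H (proj₁ x)
    ; end₂-vertex = λ x → end₂-vertex H (proj₁ x)
    ; vertex-ends = λ v →
        (proj₁ (vertex-ends H v) , inj₁ ≡.refl) , (proj₂ (vertex-ends H v) , inj₁ ≡.refl)
    ; ends-resp = ends-resp′
    }

  copy : Bool → Hom 𝒞 H Glued
  copy i = record
    { fun = λ b → b , i
    ; resp = λ b≈b' → b≈b' , inj₁ ≡.refl
    ; pres-vertex = λ v → v
    ; pres-ends = λ b → inj₁ ((≈-refl H , inj₁ ≡.refl) , (≈-refl H , inj₁ ≡.refl))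
    ; strict = strictness 𝒞 (λ b → b , i) (λ _ _ edge → edge) }

  copies-agree : copy false ∘ φ ≈ₕ copy true ∘ φ
  copies-agree = ∘-pointwise λ a → ≈-refl H , inj₂ (a , ≈-refl H)

  glued-copies⇒Image : ∀ {b} → _≈_ Glued (b , false) (b , true) → Image φ b
  glued-copies⇒Image (_ , inj₂ im) = im

Epi : (𝒞 : Cat) {G H : Graph} → Hom 𝒞 G H → Set₁
Epi 𝒞 {H = H} c = ∀ {X} (g g' : Hom 𝒞 H X) → g ∘ c ≈ₕ g' ∘ c → g ≈ₕ g'

Mono : (𝒞 : Cat) {G H : Graph} → Hom 𝒞 G H → Set₁
Mono 𝒞 {G = G} e = ∀ {X} (g g' : Hom 𝒞 X G) → e ∘ g ≈ₕ e ∘ g' → g ≈ₕ g'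

module _ {𝒞 : Cat} where

  coequalizer⇒epi : {A B C : Graph} {u v : Hom 𝒞 A B} {c : Hom 𝒞 B C} →
    IsCoequalizer 𝒞 u v c → Epi 𝒞 c
  coequalizer⇒epi {u = u} {v} {c} (cu≗cv , universal) {X} g g' gc≈g'c =
    ≈ₕ-trans (≈factor g ≈ₕ-refl) (≈ₕ-sym (≈factor g' (≈ₕ-sym gc≈g'c)))
    where
    gc-coequalizes : (g ∘ c) ∘ u ≈ₕ (g ∘ c) ∘ v
    gc-coequalizes = begin
      (g ∘ c) ∘ u   ≈⟨ ∘-assoc g c u ⟩
      g ∘ (c ∘ u)   ≈⟨ ∘-resp-≈ₕʳ (≗⇒≈ₕ cu≗cv) ⟩
      g ∘ (c ∘ v)   ≈⟨ ∘-assoc g c v ⟨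
      (g ∘ c) ∘ v   ∎
      where open SetoidReasoning (Homs 𝒞 _ X)
    factor = universal X (g ∘ c) (at gc-coequalizes)
    ≈factor : (h : Hom 𝒞 _ X) → h ∘ c ≈ₕ g ∘ c → h ≈ₕ proj₁ factor
    ≈factor h hc≈gc = ≗⇒≈ₕ (proj₂ (proj₂ factor) h (at hc≈gc))

  equalizer⇒mono : {A B E : Graph} {u v : Hom 𝒞 A B} {e : Hom 𝒞 E A} →
    IsEqualizer 𝒞 u v e → Mono 𝒞 e
  equalizer⇒mono {u = u} {v} {e} (ue≗ve , universal) {X} g g' eg≈eg' =
    ≈ₕ-trans (≈factor g ≈ₕ-refl) (≈ₕ-sym (≈factor g' (≈ₕ-sym eg≈eg')))
    where
    eg-equalized : u ∘ (e ∘ g) ≈ₕ v ∘ (e ∘ g)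
    eg-equalized = begin
      u ∘ (e ∘ g)   ≈⟨ ∘-assoc u e g ⟨
      (u ∘ e) ∘ g   ≈⟨ ∘-resp-≈ₕˡ (≗⇒≈ₕ ue≗ve) ⟩
      (v ∘ e) ∘ g   ≈⟨ ∘-assoc v e g ⟩
      v ∘ (e ∘ g)   ∎
      where open SetoidReasoning (Homs 𝒞 X _)
    factor = universal X (e ∘ g) (at eg-equalized)
    ≈factor : (h : Hom 𝒞 X _) → e ∘ h ≈ₕ e ∘ g → h ≈ₕ proj₁ factor
    ≈factor h eh≈eg = ≗⇒≈ₕ (proj₂ (proj₂ factor) h (at eh≈eg))

  epi⇒surjective : {G H : Graph} {c : Hom 𝒞 G H} → Epi 𝒞 c → Surjective c
  epi⇒surjective {c = c} epi b =
    glued-copies⇒Image c (at (epi (copy c false) (copy c true) (copies-agree c)) b)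

  mono⇒injective : {G H : Graph} {e : Hom 𝒞 G H} → Mono 𝒞 e → Injective e
  mono⇒injective {G} {e = e} mono ey≈ey' =
    ≡.subst₂ (_≈_ G) left-body right-body (at (mono left right agree) body)
    where open Probe (probe e ey≈ey')

module _ {𝒞 : Cat} {A B : Graph} (f : Hom 𝒞 A B) where

  kernel-pair-coequalizer-identifies : {AA R C : Graph} {p₀ p₁ : Hom 𝒞 AA A} {k : Hom 𝒞 R AA} →
    IsProduct 𝒞 p₀ p₁ → IsEqualizer 𝒞 (f ∘ p₀) (f ∘ p₁) k →
    (c : Hom 𝒞 A C) → c ∘ (p₀ ∘ k) ≗ c ∘ (p₁ ∘ k) →
    ∀ {a a'} → _≈_ B (fun f a) (fun f a') → _≈_ C (fun c a) (fun c a')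
  kernel-pair-coequalizer-identifies {C = C} {p₀} {p₁} {k} product (_ , universal) c c-coequalizes
    {a} {a'} fa≈fa' =
    ≡.subst₂ (λ y y' → _≈_ C (fun c y) (fun c y')) left-body right-body (∘-at c-agrees body)
    where
    open Probe (probe f fa≈fa')
    X = Link (IsVertex A a × IsVertex A a')

    paired = product X left right
    t : Hom 𝒞 X _
    t = proj₁ paired

    p₀t≈left : p₀ ∘ t ≈ₕ left
    p₀t≈left = ≗⇒≈ₕ (proj₁ (proj₁ (proj₂ paired)))

    p₁t≈right : p₁ ∘ t ≈ₕ right
    p₁t≈right = ≗⇒≈ₕ (proj₂ (proj₁ (proj₂ paired)))

    t-in-kernel : (f ∘ p₀) ∘ t ≈ₕ (f ∘ p₁) ∘ t
    t-in-kernel = begin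
      (f ∘ p₀) ∘ t   ≈⟨ ∘-assoc f p₀ t ⟩
      f ∘ (p₀ ∘ t)   ≈⟨ ∘-resp-≈ₕʳ p₀t≈left ⟩
      f ∘ left       ≈⟨ agree ⟩
      f ∘ right      ≈⟨ ∘-resp-≈ₕʳ p₁t≈right ⟨
      f ∘ (p₁ ∘ t)   ≈⟨ ∘-assoc f p₁ t ⟨
      (f ∘ p₁) ∘ t   ∎
      where open SetoidReasoning (Homs 𝒞 X B)

    lift = universal X t (at t-in-kernel)
    u : Hom 𝒞 X _
    u = proj₁ lift

    ku≈t : k ∘ u ≈ₕ t
    ku≈t = ≗⇒≈ₕ (proj₁ (proj₂ lift))

    through-kernel : {m : Hom 𝒞 X A} (p : Hom 𝒞 _ A) → p ∘ t ≈ₕ m →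
      c ∘ m ≈ₕ (c ∘ (p ∘ k)) ∘ u
    through-kernel {m} p pt≈m = begin
      c ∘ m              ≈⟨ ∘-resp-≈ₕʳ pt≈m ⟨
      c ∘ (p ∘ t)        ≈⟨ ∘-resp-≈ₕʳ (∘-resp-≈ₕʳ ku≈t) ⟨
      c ∘ (p ∘ (k ∘ u))  ≈⟨ ∘-resp-≈ₕʳ (∘-assoc p k u) ⟨
      c ∘ ((p ∘ k) ∘ u)  ≈⟨ ∘-assoc c (p ∘ k) u ⟨
      (c ∘ (p ∘ k)) ∘ u  ∎
      where open SetoidReasoning (Homs 𝒞 X C)

    c-agrees : c ∘ left ≈ₕ c ∘ right
    c-agrees = begin
      c ∘ left            ≈⟨ through-kernel p₀ p₀t≈left ⟩
      (c ∘ (p₀ ∘ k)) ∘ u  ≈⟨ ∘-resp-≈ₕˡ (≗⇒≈ₕ c-coequalizes) ⟩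
      (c ∘ (p₁ ∘ k)) ∘ u  ≈⟨ through-kernel p₁ p₁t≈right ⟨
      c ∘ right           ∎
      where open SetoidReasoning (Homs 𝒞 X C)

  cokernel-pair-equalizer-in-image : {BB Q E : Graph} {i₀ i₁ : Hom 𝒞 B BB} {k* : Hom 𝒞 BB Q} →
    IsCoproduct 𝒞 i₀ i₁ → IsCoequalizer 𝒞 (i₀ ∘ f) (i₁ ∘ f) k* →
    (e : Hom 𝒞 E B) → (k* ∘ i₀) ∘ e ≗ (k* ∘ i₁) ∘ e → ∀ x → Image f (fun e x)
  cokernel-pair-equalizer-in-image {E = E} {i₀} {i₁} {k*} coproduct (_ , universal) e e-equalizes x =
    glued-copies⇒Image f (∘-at copies-agree-on-e x)
    where
    copairing = coproduct (Glued f) (copy f false) (copy f true)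
    w : Hom 𝒞 _ (Glued f)
    w = proj₁ copairing

    wi₀≈copy : w ∘ i₀ ≈ₕ copy f false
    wi₀≈copy = ≗⇒≈ₕ (proj₁ (proj₁ (proj₂ copairing)))

    wi₁≈copy : w ∘ i₁ ≈ₕ copy f true
    wi₁≈copy = ≗⇒≈ₕ (proj₂ (proj₁ (proj₂ copairing)))

    w-coequalizes : w ∘ (i₀ ∘ f) ≈ₕ w ∘ (i₁ ∘ f)
    w-coequalizes = begin
      w ∘ (i₀ ∘ f)     ≈⟨ ∘-assoc w i₀ f ⟨
      (w ∘ i₀) ∘ f     ≈⟨ ∘-resp-≈ₕˡ wi₀≈copy ⟩
      copy f false ∘ f ≈⟨ copies-agree f ⟩
      copy f true ∘ f  ≈⟨ ∘-resp-≈ₕˡ wi₁≈copy ⟨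
      (w ∘ i₁) ∘ f     ≈⟨ ∘-assoc w i₁ f ⟩
      w ∘ (i₁ ∘ f)     ∎
      where open SetoidReasoning (Homs 𝒞 A (Glued f))

    factor = universal (Glued f) w (at w-coequalizes)
    u : Hom 𝒞 _ (Glued f)
    u = proj₁ factor

    uk*≈w : u ∘ k* ≈ₕ w
    uk*≈w = ≗⇒≈ₕ (proj₁ (proj₂ factor))

    through-cokernel : {cp : Hom 𝒞 B (Glued f)} (i : Hom 𝒞 B _) → w ∘ i ≈ₕ cp →
      (u ∘ (k* ∘ i)) ∘ e ≈ₕ cp ∘ e
    through-cokernel {cp} i wi≈cp = begin
      (u ∘ (k* ∘ i)) ∘ e  ≈⟨ ∘-resp-≈ₕˡ (∘-assoc u k* i) ⟨
      ((u ∘ k*) ∘ i) ∘ e  ≈⟨ ∘-resp-≈ₕˡ (∘-resp-≈ₕˡ uk*≈w) ⟩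
      (w ∘ i) ∘ e         ≈⟨ ∘-resp-≈ₕˡ wi≈cp ⟩
      cp ∘ e              ∎
      where open SetoidReasoning (Homs 𝒞 E (Glued f))

    copies-agree-on-e : copy f false ∘ e ≈ₕ copy f true ∘ e
    copies-agree-on-e = begin
      copy f false ∘ e     ≈⟨ through-cokernel i₀ wi₀≈copy ⟨
      (u ∘ (k* ∘ i₀)) ∘ e  ≈⟨ ∘-assoc u (k* ∘ i₀) e ⟩
      u ∘ ((k* ∘ i₀) ∘ e)  ≈⟨ ∘-resp-≈ₕʳ (≗⇒≈ₕ e-equalizes) ⟩
      u ∘ ((k* ∘ i₁) ∘ e)  ≈⟨ ∘-assoc u (k* ∘ i₁) e ⟨
      (u ∘ (k* ∘ i₁)) ∘ e  ≈⟨ through-cokernel i₁ wi₁≈copy ⟩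
      copy f true ∘ e      ∎
      where open SetoidReasoning (Homs 𝒞 E (Glued f))

module _ {𝒞 : Cat} where

  coequalizer-equalizer-diagonal : {A A' B B' I I* : Graph} {u v : Hom 𝒞 A' A} {s t : Hom 𝒞 B B'}
    {c : Hom 𝒞 A I} {e : Hom 𝒞 I* B} {f : Hom 𝒞 A B} →
    IsCoequalizer 𝒞 u v c → IsEqualizer 𝒞 s t e →
    f ∘ u ≈ₕ f ∘ v → s ∘ f ≈ₕ t ∘ f →
    Σ (Hom 𝒞 I I*) λ h → e ∘ (h ∘ c) ≈ₕ f
  coequalizer-equalizer-diagonal {A} {B = B} {B'} {I} {I*} {s = s} {t} {c} {e} {f}
    coequalizer@(_ , factor-c) (_ , factor-e) fu≈fv sf≈tf = h , e-h-c≈f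
    where
    f̄ : Hom 𝒞 I B
    f̄ = proj₁ (factor-c B f (at fu≈fv))

    f̄c≈f : f̄ ∘ c ≈ₕ f
    f̄c≈f = ≗⇒≈ₕ (proj₁ (proj₂ (factor-c B f (at fu≈fv))))

    f̄-equalized : s ∘ f̄ ≈ₕ t ∘ f̄
    f̄-equalized = coequalizer⇒epi coequalizer (s ∘ f̄) (t ∘ f̄) (begin
      (s ∘ f̄) ∘ c   ≈⟨ ∘-assoc s f̄ c ⟩
      s ∘ (f̄ ∘ c)   ≈⟨ ∘-resp-≈ₕʳ f̄c≈f ⟩
      s ∘ f         ≈⟨ sf≈tf ⟩
      t ∘ f         ≈⟨ ∘-resp-≈ₕʳ f̄c≈f ⟨
      t ∘ (f̄ ∘ c)   ≈⟨ ∘-assoc t f̄ c ⟨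
      (t ∘ f̄) ∘ c   ∎)
      where open SetoidReasoning (Homs 𝒞 A B')

    h : Hom 𝒞 I I*
    h = proj₁ (factor-e I f̄ (at f̄-equalized))

    eh≈f̄ : e ∘ h ≈ₕ f̄
    eh≈f̄ = ≗⇒≈ₕ (proj₁ (proj₂ (factor-e I f̄ (at f̄-equalized))))

    e-h-c≈f : e ∘ (h ∘ c) ≈ₕ f
    e-h-c≈f = begin
      e ∘ (h ∘ c)   ≈⟨ ∘-assoc e h c ⟨
      (e ∘ h) ∘ c   ≈⟨ ∘-resp-≈ₕˡ eh≈f̄ ⟩
      f̄ ∘ c         ≈⟨ f̄c≈f ⟩
      f             ∎
      where open SetoidReasoning (Homs 𝒞 A B)

module _ {𝒞 : Cat} {A B I I* : Graph} {f : Hom 𝒞 A B} {q : Hom 𝒞 A I} {q* : Hom 𝒞 I* B}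
  {h : Hom 𝒞 I I*} (factorises : q* ∘ (h ∘ q) ≈ₕ f)
  (q-surjective : Surjective q) (q*-injective : Injective q*)
  (identifies : ∀ {a a'} → _≈_ B (fun f a) (fun f a') → _≈_ I (fun q a) (fun q a'))
  (in-image : ∀ x → Image f (fun q* x)) where

  private
    factorises-at : ∀ a → _≈_ B (fun q* (fun h (fun q a))) (fun f a)
    factorises-at a = begin
      fun q* (fun h (fun q a))   ≡⟨ ≡.cong (fun q*) (fun-∘ 𝒞 h q a) ⟨
      fun q* (fun (h ∘ q) a)     ≡⟨ fun-∘ 𝒞 q* (h ∘ q) a ⟨
      fun (q* ∘ (h ∘ q)) a       ≈⟨ at factorises a ⟩
      fun f a                    ∎
      where open SetoidReasoning (parts B)

    preimage : Part I* → Part A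
    preimage x = proj₁ (in-image x)

    q*≈f-preimage : ∀ x → _≈_ B (fun q* x) (fun f (preimage x))
    q*≈f-preimage x = proj₂ (in-image x)

    g : Part I* → Part I
    g x = fun q (preimage x)

    g-resp : ∀ {x x'} → _≈_ I* x x' → _≈_ I (g x) (g x')
    g-resp {x} {x'} x≈x' = identifies (begin
      fun f (preimage x)    ≈⟨ q*≈f-preimage x ⟨
      fun q* x              ≈⟨ resp q* x≈x' ⟩
      fun q* x'             ≈⟨ q*≈f-preimage x' ⟩
      fun f (preimage x')   ∎)
      where open SetoidReasoning (parts B)

    g-vertex : ∀ {x} → IsVertex I* x → IsVertex I (g x)
    g-vertex {x} x-vertex = vertex-resp I (identifies fa₁≈fa) (pres-vertex q (end₁-vertex A a))
      where
      a = preimage x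
      fa-vertex : IsVertex B (fun f a)
      fa-vertex = vertex-resp B (q*≈f-preimage x) (pres-vertex q* x-vertex)
      fa₁≈fa : _≈_ B (fun f (end₁ A a)) (fun f a)
      fa₁≈fa = proj₁ (ends-≈-vertex B fa-vertex (pres-ends f a))

    g-ends : ∀ x → UPairEq I (end₁ I (g x)) (end₂ I (g x)) (g (end₁ I* x)) (g (end₂ I* x))
    g-ends x = UPairEq-trans I (pres-ends q a) (UPairEq-map {G = B} {I} (fun f) (fun q) identifies f-ends)
      where
      a = preimage x
      f-ends : UPairEq B (fun f (end₁ A a)) (fun f (end₂ A a))
                         (fun f (preimage (end₁ I* x))) (fun f (preimage (end₂ I* x)))
      f-ends = UPairEq-trans B (UPairEq-sym B (pres-ends f a))
        (UPairEq-trans B (ends-resp B (≈-sym B (q*≈f-preimage x)))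
          (UPairEq-trans B (pres-ends q* x)
            (inj₁ (q*≈f-preimage (end₁ I* x) , q*≈f-preimage (end₂ I* x)))))

    q*hg≈q* : ∀ x → _≈_ B (fun q* (fun h (g x))) (fun q* x)
    q*hg≈q* x = ≈-trans B (factorises-at (preimage x)) (≈-sym B (q*≈f-preimage x))

    g-edge : 𝒞 ≡ StGrphs → ∀ x → IsEdge I* x → IsEdge I (g x)
    g-edge strict x x-edge gx-vertex = preserves-edges q* strict x x-edge
      (vertex-resp B (q*hg≈q* x) (pres-vertex q* (pres-vertex h gx-vertex)))

    inverse : Hom 𝒞 I* I
    inverse = record { fun = g ; resp = g-resp ; pres-vertex = g-vertex ; pres-ends = g-ends
                     ; strict = strictness 𝒞 g g-edge }

    inverse∘h≗id : inverse ∘ h ≗ idH {𝒞}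
    inverse∘h≗id z = begin
      fun (inverse ∘ h) z         ≡⟨ fun-∘ 𝒞 inverse h z ⟩
      g (fun h z)                 ≈⟨ identifies f-preimage≈fa ⟩
      fun q a                     ≈⟨ z≈qa ⟨
      z                           ≡⟨ fun-id 𝒞 z ⟨
      fun (idH {𝒞}) z             ∎
      where
      open SetoidReasoning (parts I)
      a = proj₁ (q-surjective z)
      z≈qa = proj₂ (q-surjective z)
      f-preimage≈fa : _≈_ B (fun f (preimage (fun h z))) (fun f a)
      f-preimage≈fa = ≈-trans B (≈-sym B (q*≈f-preimage (fun h z)))
        (≈-trans B (resp q* (resp h z≈qa)) (factorises-at a))

    h∘inverse≗id : h ∘ inverse ≗ idH {𝒞}
    h∘inverse≗id x = begin
      fun (h ∘ inverse) x   ≡⟨ fun-∘ 𝒞 h inverse x ⟩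
      fun h (g x)           ≈⟨ q*-injective (q*hg≈q* x) ⟩
      x                     ≡⟨ fun-id 𝒞 x ⟨
      fun (idH {𝒞}) x       ∎
      where open SetoidReasoning (parts I*)

  middle-factor-isIso : IsIso 𝒞 h
  middle-factor-isIso = inverse , inverse∘h≗id , h∘inverse≗id

mainTheorem3 : (𝒞 : Cat) {A B : Graph} (f : Hom 𝒞 A B)
    (AA : Graph) (p₀ p₁ : Hom 𝒞 AA A) → IsProduct 𝒞 p₀ p₁ →
    (BB : Graph) (i₀ i₁ : Hom 𝒞 B BB) → IsCoproduct 𝒞 i₀ i₁ →
    (R : Graph) (k : Hom 𝒞 R AA) → IsEqualizer 𝒞 (f ∘ p₀) (f ∘ p₁) k →
    (I : Graph) (q : Hom 𝒞 A I) → IsCoequalizer 𝒞 (p₀ ∘ k) (p₁ ∘ k) q →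
    (R* : Graph) (k* : Hom 𝒞 BB R*) → IsCoequalizer 𝒞 (i₀ ∘ f) (i₁ ∘ f) k* →
    (I* : Graph) (q* : Hom 𝒞 I* B) → IsEqualizer 𝒞 (k* ∘ i₀) (k* ∘ i₁) q* →
    Σ (Hom 𝒞 I I*) (λ h →
      (q* ∘ h ∘ q ≗ f) ×
      ((h' : Hom 𝒞 I I*) → q* ∘ h' ∘ q ≗ f → h' ≗ h) ×
      IsIso 𝒞 h)
mainTheorem3 𝒞 f AA p₀ p₁ product BB i₀ i₁ coproduct R k kernel I q coeq R* k* cokernel I* q* eq =
  h , at factorises , unique ,
  middle-factor-isIso factorises (epi⇒surjective q-epi) (mono⇒injective q*-mono)
    (kernel-pair-coequalizer-identifies f product kernel q (proj₁ coeq))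
    (cokernel-pair-equalizer-in-image f coproduct cokernel q* (proj₁ eq))
  where
  q-epi : Epi 𝒞 q
  q-epi = coequalizer⇒epi coeq

  q*-mono : Mono 𝒞 q*
  q*-mono = equalizer⇒mono {u = k* ∘ i₀} {k* ∘ i₁} eq

  f-coequalizes : f ∘ (p₀ ∘ k) ≈ₕ f ∘ (p₁ ∘ k)
  f-coequalizes =
    ≈ₕ-trans (≈ₕ-sym (∘-assoc f p₀ k)) (≈ₕ-trans (≗⇒≈ₕ (proj₁ kernel)) (∘-assoc f p₁ k))

  f-equalized : (k* ∘ i₀) ∘ f ≈ₕ (k* ∘ i₁) ∘ f
  f-equalized =
    ≈ₕ-trans (∘-assoc k* i₀ f) (≈ₕ-trans (≗⇒≈ₕ (proj₁ cokernel)) (≈ₕ-sym (∘-assoc k* i₁ f)))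

  diagonal : Σ (Hom 𝒞 I I*) λ h → q* ∘ (h ∘ q) ≈ₕ f
  diagonal = coequalizer-equalizer-diagonal coeq eq f-coequalizes f-equalized

  h : Hom 𝒞 I I*
  h = proj₁ diagonal

  factorises : q* ∘ (h ∘ q) ≈ₕ f
  factorises = proj₂ diagonal

  unique : (h' : Hom 𝒞 I I*) → q* ∘ h' ∘ q ≗ f → h' ≗ h
  unique h' h'-factorises =
    at (q-epi h' h (q*-mono (h' ∘ q) (h ∘ q)
      (≈ₕ-trans (≗⇒≈ₕ h'-factorises) (≈ₕ-sym factorises))))
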